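{- For positive integers $r, k$ define $$S_{r,k} := \sum_{n=1}^{+\infty} \frac{(-1)^{(r-1)(n-1)}}{F_{rn} F_{r(n+k)}}.$$ Then for every positive integer $r$ and every odd positive integer $k$, $$S_{r,k} = \frac{F_r}{F_{rk}}\left(S_{r,1} + (-1)^r \sum_{n=1}^{(k-1)/2} \frac{1}{F_{2nr} F_{(2n+1)r}}\right).$$
   Context: $(F_n)$ is the Fibonacci sequence: $F_0 = 0$, $F_1 = 1$, $F_{n+2} = F_{n+1} + F_n$. An empty sum equals $0$. -}

module Defs where

open import Data.Nat as ℕ using (ℕ; zero; suc)
open import Data.Integer as ℤ using (ℤ; +_)
open import Data.Rational using (ℚ; 0ℚ; _/_; _+_; _-_; _<_; ∣_∣)
open import Data.Product using (∃; ∃-syntax)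

fib : ℕ → ℕ
fib zero = 0
fib (suc zero) = 1
fib (suc (suc n)) = ℕ._+_ (fib (suc n)) (fib n)

sgn : ℕ → ℤ
sgn zero = + 1
sgn (suc m) = ℤ.-_ (sgn m)

-- z / d as a rational; convention z / 0 := 0 (only ever applied to d > 0 here)
divℕ : ℤ → ℕ → ℚ
divℕ z zero = 0ℚ
divℕ z (suc d) = z / suc d

sumFrom1 : ℕ → (ℕ → ℚ) → ℚ
sumFrom1 zero f = 0ℚ
sumFrom1 (suc N) f = sumFrom1 N f + f (suc N)

term : ℕ → ℕ → ℕ → ℚ
term r k n = divℕ (sgn (ℕ._*_ (ℕ._∸_ r 1) (ℕ._∸_ n 1)))
                  (ℕ._*_ (fib (ℕ._*_ r n)) (fib (ℕ._*_ r (ℕ._+_ n k))))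

partialS : ℕ → ℕ → ℕ → ℚ
partialS r k N = sumFrom1 N (term r k)

finiteSum : ℕ → ℕ → ℚ
finiteSum r M = sumFrom1 M (λ n → divℕ (+ 1)
  (ℕ._*_ (fib (ℕ._*_ (ℕ._*_ 2 n) r)) (fib (ℕ._*_ (suc (ℕ._*_ 2 n)) r))))

Cauchy : (ℕ → ℚ) → Set
Cauchy s = ∀ ε → 0ℚ < ε → ∃[ N ] (∀ m n → ℕ._≤_ N m → ℕ._≤_ N n → ∣ s m - s n ∣ < ε)

ConvergesTo : (ℕ → ℚ) → ℚ → Set
ConvergesTo s L = ∀ ε → 0ℚ < ε → ∃[ N ] (∀ m → ℕ._≤_ N m → ∣ s m - L ∣ < ε)

{-# OPTIONS --safe #-}
module Submission where

open import Defs
open import Data.Nat.Base using (ℕ)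

-- Write ρ n = F(rn+1)/F(rn).  D'Ocagne's identity F(b+1) F(b+c) − F(b+c+1) F(b) = (−1)^b F(c) gives
-- ρ n − ρ (n+m) = (−1)^(rn) F(rm) / (F(rn) F(r(n+m))), so the n-th term of S(r,k) is ±(ρ n − ρ (n+k))/F(rk),
-- and the n-th summand of S(r,k) − (F(r)/F(rk)) S(r,1) is ±(ρ (n+1) − ρ (n+k))/F(rk).  For k = 2j+1 that
-- difference is the sum of the gaps ρ i − ρ (i+1) for n+1 ≤ i < n+k, i.e. g(n−1) + g(n) with
-- g(N) = Σ_{l=1}^{j} (ρ (N+2l) − ρ (N+2l+1)).  As the sign alternates in n, the N-th partial sum telescopes
-- to ±g(0)/F(rk) ± g(N)/F(rk); the gaps in g(0) are F(r)/(F(2lr) F((2l+1)r)), which yields the finite sum,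
-- and |g(N)| ≤ j/(N+1).  Both series converge absolutely: their n-th terms are at most
-- 2/(F(n) F(n+2)) = 2/(F(n) F(n+1)) − 2/(F(n+1) F(n+2)).

module Sign where

  open import Data.Nat.Base using (zero; suc; _+_)
  open import Data.Nat.Properties using (+-suc)
  open import Data.Integer.Base as ℤ using (+_)
  import Data.Integer.Properties as ℤ
  open import Function.Base using (_∘′_)
  open import Relation.Binary.PropositionalEquality

  sgn-+ : ∀ m n → sgn (m + n) ≡ sgn m ℤ.* sgn n
  sgn-+ zero    n = sym (ℤ.*-identityˡ (sgn n))
  sgn-+ (suc m) n = trans (cong ℤ.-_ (sgn-+ m n)) (ℤ.neg-distribˡ-* (sgn m) (sgn n))

  sgn-even : ∀ m → sgn (m + m) ≡ + 1
  sgn-even zero    = refl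
  sgn-even (suc m) = begin
    ℤ.- sgn (m + suc m)     ≡⟨ cong (ℤ.-_ ∘′ sgn) (+-suc m m) ⟩
    ℤ.- ℤ.- sgn (m + m)     ≡⟨ ℤ.neg-involutive (sgn (m + m)) ⟩
    sgn (m + m)             ≡⟨ sgn-even m ⟩
    + 1                     ∎
    where open ≡-Reasoning

  ∣sgn∣≡1 : ∀ m → ℤ.∣ sgn m ∣ ≡ 1
  ∣sgn∣≡1 zero    = refl
  ∣sgn∣≡1 (suc m) = trans (ℤ.∣-i∣≡∣i∣ (sgn m)) (∣sgn∣≡1 m)

module Fibonacci where

  open import Data.Nat.Base using (zero; suc; _+_; _*_; _≤_; z≤n; s≤s)
  open import Data.Nat.Properties
    using (≤-refl; ≤-trans; ≤-reflexive; m≤m+n; m≤n⇒m<n∨m≡n; +-mono-≤; +-monoʳ-≤; +-comm)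
  open import Data.Integer.Base as ℤ using (+_)
  import Data.Integer.Properties as ℤ
  open import Data.Integer.Tactic.RingSolver using (solve-∀)
  open import Data.Sum.Base using (inj₁; inj₂)
  open import Relation.Binary.PropositionalEquality

  fib-pos : ∀ {n} → 1 ≤ n → 1 ≤ fib n
  fib-pos {suc zero}    _ = ≤-refl
  fib-pos {suc (suc n)} _ = ≤-trans (fib-pos {suc n} (s≤s z≤n)) (m≤m+n (fib (suc n)) (fib n))

  fib-≤-suc : ∀ n → fib n ≤ fib (suc n)
  fib-≤-suc zero    = z≤n
  fib-≤-suc (suc n) = m≤m+n (fib (suc n)) (fib n)

  fib-mono : ∀ {m n} → m ≤ n → fib m ≤ fib n
  fib-mono {n = zero}  z≤n = ≤-refl
  fib-mono {n = suc n} m≤1+n with m≤n⇒m<n∨m≡n m≤1+n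
  ... | inj₁ (s≤s m≤n) = ≤-trans (fib-mono m≤n) (fib-≤-suc n)
  ... | inj₂ refl      = ≤-refl

  1+n≤fib[2+n] : ∀ n → suc n ≤ fib (suc (suc n))
  1+n≤fib[2+n] zero    = ≤-refl
  1+n≤fib[2+n] (suc n) = ≤-trans (≤-reflexive (+-comm 1 (suc n)))
                                 (+-mono-≤ (1+n≤fib[2+n] n) (fib-pos {suc n} (s≤s z≤n)))

  fib[2+n]≤2*fib[1+n] : ∀ n → fib (suc (suc n)) ≤ 2 * fib (suc n)
  fib[2+n]≤2*fib[1+n] n = +-monoʳ-≤ (fib (suc n)) (≤-trans (fib-≤-suc n) (m≤m+n (fib (suc n)) 0))

  fib-dOcagne : ∀ b c →
    + fib (suc b) ℤ.* + fib (b + c) ℤ.- + fib (suc (b + c)) ℤ.* + fib b ≡ sgn b ℤ.* + fib c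
  fib-dOcagne zero    c = base (+ fib c) (+ fib (suc c))
    where
    base : ∀ x y → + 1 ℤ.* x ℤ.- y ℤ.* + 0 ≡ + 1 ℤ.* x
    base = solve-∀
  fib-dOcagne (suc b) c = begin
    + fib (suc (suc b)) ℤ.* + fib (suc (b + c)) ℤ.- + fib (suc (suc (b + c))) ℤ.* + fib (suc b)
      ≡⟨ cong₂ (λ x y → x ℤ.* + fib (suc (b + c)) ℤ.- y ℤ.* + fib (suc b))
               (ℤ.pos-+ (fib (suc b)) (fib b)) (ℤ.pos-+ (fib (suc (b + c))) (fib (b + c))) ⟩
    (+ fib (suc b) ℤ.+ + fib b) ℤ.* + fib (suc (b + c)) ℤ.- (+ fib (suc (b + c)) ℤ.+ + fib (b + c)) ℤ.* + fib (suc b)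
      ≡⟨ step (+ fib (suc b)) (+ fib b) (+ fib (suc (b + c))) (+ fib (b + c)) ⟩
    ℤ.- (+ fib (suc b) ℤ.* + fib (b + c) ℤ.- + fib (suc (b + c)) ℤ.* + fib b)
      ≡⟨ cong ℤ.-_ (fib-dOcagne b c) ⟩
    ℤ.- (sgn b ℤ.* + fib c)
      ≡⟨ ℤ.neg-distribˡ-* (sgn b) (+ fib c) ⟩
    sgn (suc b) ℤ.* + fib c ∎
    where
    open ≡-Reasoning
    step : ∀ x₁ x₀ y₁ y₀ → (x₁ ℤ.+ x₀) ℤ.* y₁ ℤ.- (y₁ ℤ.+ y₀) ℤ.* x₁ ≡ ℤ.- (x₁ ℤ.* y₀ ℤ.- y₁ ℤ.* x₀)
    step = solve-∀

module Rationals where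

  open import Data.Nat.Base as ℕ using (ℕ; zero; suc; z≤n; s≤s)
  import Data.Nat.Properties as ℕ
  open import Data.Integer.Base as ℤ using (ℤ; +_; -[1+_])
  import Data.Integer.Properties as ℤ
  open import Data.Integer.Tactic.RingSolver using (solve-∀)
  open import Data.Rational.Base
    using (ℚ; mkℚ; 0ℚ; 1ℚ; _+_; _*_; _-_; -_; ∣_∣; _≤_; _<_; *<*; toℚᵘ)
  import Data.Rational.Properties as ℚ
  open import Data.Rational.Unnormalised.Base as ℚᵘ using (mkℚᵘ; _≃_; *≡*)
  import Data.Rational.Unnormalised.Properties as ℚᵘ
  open import Data.Product.Base using (Σ; _,_)
  open import Relation.Binary.PropositionalEquality
  open Sign

  fromℤ : ℤ → ℚ
  fromℤ z = divℕ z 1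

  -- recip 0 = 0, as for divℕ.
  recip : ℕ → ℚ
  recip n = divℕ (+ 1) n

  sign : ℕ → ℚ
  sign m = fromℤ (sgn m)

  -- Identities for divℕ are proved in ℚᵘ, where the operations act on numerators and denominators directly.
  toℚᵘ-divℕ : ∀ z d → toℚᵘ (divℕ z (suc d)) ≃ mkℚᵘ z d
  toℚᵘ-divℕ z d = ℚ.toℚᵘ-fromℚᵘ (mkℚᵘ z d)

  divℕ≡fromℤ*recip : ∀ z n → divℕ z n ≡ fromℤ z * recip n
  divℕ≡fromℤ*recip z zero    = sym (ℚ.*-zeroʳ (fromℤ z))
  divℕ≡fromℤ*recip z (suc d) = ℚ.toℚᵘ-injective (begin-equality
    toℚᵘ (divℕ z (suc d))                     ≃⟨ toℚᵘ-divℕ z d ⟩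
    mkℚᵘ z d                                  ≃⟨ *≡* (identity z (+ suc d)) ⟩
    mkℚᵘ z 0 ℚᵘ.* mkℚᵘ (+ 1) d                ≃⟨ ℚᵘ.*-cong (toℚᵘ-divℕ z 0) (toℚᵘ-divℕ (+ 1) d) ⟨
    toℚᵘ (fromℤ z) ℚᵘ.* toℚᵘ (recip (suc d))  ≃⟨ ℚ.toℚᵘ-homo-* (fromℤ z) (recip (suc d)) ⟨
    toℚᵘ (fromℤ z * recip (suc d))            ∎)
    where
    open ℚᵘ.≤-Reasoning
    identity : ∀ z D → z ℤ.* (+ 1 ℤ.* D) ≡ (z ℤ.* + 1) ℤ.* D
    identity = solve-∀

  recip-* : ∀ m n → recip (m ℕ.* n) ≡ recip m * recip n
  recip-* zero    n       = sym (ℚ.*-zeroˡ (recip n))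
  recip-* (suc a) zero    = trans (cong recip (ℕ.*-zeroʳ a)) (sym (ℚ.*-zeroʳ (recip (suc a))))
  recip-* (suc a) (suc b) = ℚ.toℚᵘ-injective (begin-equality
    toℚᵘ (recip (suc a ℕ.* suc b))                  ≃⟨ toℚᵘ-divℕ (+ 1) (b ℕ.+ a ℕ.* suc b) ⟩
    mkℚᵘ (+ 1) (b ℕ.+ a ℕ.* suc b)                  ≃⟨ *≡* (identity (+ suc a) (+ suc b)) ⟩
    mkℚᵘ (+ 1) a ℚᵘ.* mkℚᵘ (+ 1) b                  ≃⟨ ℚᵘ.*-cong (toℚᵘ-divℕ (+ 1) a) (toℚᵘ-divℕ (+ 1) b) ⟨
    toℚᵘ (recip (suc a)) ℚᵘ.* toℚᵘ (recip (suc b))  ≃⟨ ℚ.toℚᵘ-homo-* (recip (suc a)) (recip (suc b)) ⟨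
    toℚᵘ (recip (suc a) * recip (suc b))            ∎)
    where
    open ℚᵘ.≤-Reasoning
    identity : ∀ A B → + 1 ℤ.* (A ℤ.* B) ≡ (+ 1 ℤ.* + 1) ℤ.* (A ℤ.* B)
    identity = solve-∀

  fromℤ-+ : ∀ a b → fromℤ (a ℤ.+ b) ≡ fromℤ a + fromℤ b
  fromℤ-+ a b = ℚ.toℚᵘ-injective (begin-equality
    toℚᵘ (fromℤ (a ℤ.+ b))                ≃⟨ toℚᵘ-divℕ (a ℤ.+ b) 0 ⟩
    mkℚᵘ (a ℤ.+ b) 0                      ≃⟨ *≡* (identity a b) ⟩
    mkℚᵘ a 0 ℚᵘ.+ mkℚᵘ b 0                ≃⟨ ℚᵘ.+-cong (toℚᵘ-divℕ a 0) (toℚᵘ-divℕ b 0) ⟨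
    toℚᵘ (fromℤ a) ℚᵘ.+ toℚᵘ (fromℤ b)    ≃⟨ ℚ.toℚᵘ-homo-+ (fromℤ a) (fromℤ b) ⟨
    toℚᵘ (fromℤ a + fromℤ b)              ∎)
    where
    open ℚᵘ.≤-Reasoning
    identity : ∀ a b → (a ℤ.+ b) ℤ.* (+ 1 ℤ.* + 1) ≡ (a ℤ.* + 1 ℤ.+ b ℤ.* + 1) ℤ.* + 1
    identity = solve-∀

  fromℤ-* : ∀ a b → fromℤ (a ℤ.* b) ≡ fromℤ a * fromℤ b
  fromℤ-* a b = ℚ.toℚᵘ-injective (begin-equality
    toℚᵘ (fromℤ (a ℤ.* b))                ≃⟨ toℚᵘ-divℕ (a ℤ.* b) 0 ⟩
    mkℚᵘ (a ℤ.* b) 0                      ≃⟨ *≡* (identity a b) ⟩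
    mkℚᵘ a 0 ℚᵘ.* mkℚᵘ b 0                ≃⟨ ℚᵘ.*-cong (toℚᵘ-divℕ a 0) (toℚᵘ-divℕ b 0) ⟨
    toℚᵘ (fromℤ a) ℚᵘ.* toℚᵘ (fromℤ b)    ≃⟨ ℚ.toℚᵘ-homo-* (fromℤ a) (fromℤ b) ⟨
    toℚᵘ (fromℤ a * fromℤ b)              ∎)
    where
    open ℚᵘ.≤-Reasoning
    identity : ∀ a b → (a ℤ.* b) ℤ.* (+ 1 ℤ.* + 1) ≡ (a ℤ.* b) ℤ.* + 1
    identity = solve-∀

  fromℤ-neg : ∀ a → fromℤ (ℤ.- a) ≡ - fromℤ a
  fromℤ-neg a = ℚ.toℚᵘ-injective (begin-equality
    toℚᵘ (fromℤ (ℤ.- a))   ≃⟨ toℚᵘ-divℕ (ℤ.- a) 0 ⟩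
    mkℚᵘ (ℤ.- a) 0         ≃⟨ ℚᵘ.-‿cong (toℚᵘ-divℕ a 0) ⟨
    ℚᵘ.- toℚᵘ (fromℤ a)    ≃⟨ ℚ.toℚᵘ-homo‿- (fromℤ a) ⟨
    toℚᵘ (- fromℤ a)       ∎)
    where open ℚᵘ.≤-Reasoning

  divℕ-self : ∀ {n} → 1 ℕ.≤ n → divℕ (+ n) n ≡ 1ℚ
  divℕ-self {suc d} _ = ℚ.toℚᵘ-injective (ℚᵘ.≃-trans (toℚᵘ-divℕ (+ suc d) d) (*≡* (ℤ.*-comm (+ suc d) (+ 1))))

  fromℤ*recip-self : ∀ {n} → 1 ℕ.≤ n → fromℤ (+ n) * recip n ≡ 1ℚ
  fromℤ*recip-self {n} n≥1 = trans (sym (divℕ≡fromℤ*recip (+ n) n)) (divℕ-self n≥1)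

  divℕ-sub : ∀ p q {a b} → 1 ℕ.≤ a → 1 ℕ.≤ b →
    divℕ p a - divℕ q b ≡ divℕ (p ℤ.* + b ℤ.- q ℤ.* + a) (a ℕ.* b)
  divℕ-sub p q {suc a} {suc b} _ _ = ℚ.toℚᵘ-injective (begin-equality
    toℚᵘ (divℕ p (suc a) - divℕ q (suc b))
      ≃⟨ ℚ.toℚᵘ-homo-+ (divℕ p (suc a)) (- divℕ q (suc b)) ⟩
    toℚᵘ (divℕ p (suc a)) ℚᵘ.+ toℚᵘ (- divℕ q (suc b))
      ≃⟨ ℚᵘ.+-cong (toℚᵘ-divℕ p a) (ℚᵘ.≃-trans (ℚ.toℚᵘ-homo‿- (divℕ q (suc b))) (ℚᵘ.-‿cong (toℚᵘ-divℕ q b))) ⟩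
    mkℚᵘ p a ℚᵘ.- mkℚᵘ q b
      ≃⟨ *≡* (identity p q (+ suc a) (+ suc b) (+ suc (b ℕ.+ a ℕ.* suc b))) ⟩
    mkℚᵘ (p ℤ.* + suc b ℤ.- q ℤ.* + suc a) (b ℕ.+ a ℕ.* suc b)
      ≃⟨ toℚᵘ-divℕ (p ℤ.* + suc b ℤ.- q ℤ.* + suc a) (b ℕ.+ a ℕ.* suc b) ⟨
    toℚᵘ (divℕ (p ℤ.* + suc b ℤ.- q ℤ.* + suc a) (suc a ℕ.* suc b)) ∎)
    where
    open ℚᵘ.≤-Reasoning
    identity : ∀ p q A B D → (p ℤ.* B ℤ.+ ℤ.- q ℤ.* A) ℤ.* D ≡ (p ℤ.* B ℤ.- q ℤ.* A) ℤ.* D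
    identity = solve-∀

  recip-sub : ∀ {a} b → 1 ℕ.≤ a → recip a - recip (b ℕ.+ a) ≡ fromℤ (+ b) * (recip a * recip (b ℕ.+ a))
  recip-sub {a} b a≥1 = begin
    recip a - recip (b ℕ.+ a)
      ≡⟨ divℕ-sub (+ 1) (+ 1) a≥1 (ℕ.≤-trans a≥1 (ℕ.m≤n+m a b)) ⟩
    divℕ (+ 1 ℤ.* + (b ℕ.+ a) ℤ.- + 1 ℤ.* + a) (a ℕ.* (b ℕ.+ a))
      ≡⟨ cong (λ z → divℕ z (a ℕ.* (b ℕ.+ a))) numerator ⟩
    divℕ (+ b) (a ℕ.* (b ℕ.+ a))
      ≡⟨ divℕ≡fromℤ*recip (+ b) (a ℕ.* (b ℕ.+ a)) ⟩
    fromℤ (+ b) * recip (a ℕ.* (b ℕ.+ a))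
      ≡⟨ cong (fromℤ (+ b) *_) (recip-* a (b ℕ.+ a)) ⟩
    fromℤ (+ b) * (recip a * recip (b ℕ.+ a)) ∎
    where
    open ≡-Reasoning
    cancel : ∀ x y → + 1 ℤ.* (x ℤ.+ y) ℤ.- + 1 ℤ.* y ≡ x
    cancel = solve-∀
    numerator : + 1 ℤ.* + (b ℕ.+ a) ℤ.- + 1 ℤ.* + a ≡ + b
    numerator = trans (cong (λ z → + 1 ℤ.* z ℤ.- + 1 ℤ.* + a) (ℤ.pos-+ b a)) (cancel (+ b) (+ a))

  ∣divℕ∣ : ∀ z n → ∣ divℕ z n ∣ ≡ divℕ (+ ℤ.∣ z ∣) n
  ∣divℕ∣ z zero    = refl
  ∣divℕ∣ z (suc d) = ℚ.toℚᵘ-injective (begin-equality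
    toℚᵘ ∣ divℕ z (suc d) ∣            ≃⟨ ℚ.toℚᵘ-homo-∣-∣ (divℕ z (suc d)) ⟩
    ℚᵘ.∣ toℚᵘ (divℕ z (suc d)) ∣       ≃⟨ ℚᵘ.∣-∣-cong (toℚᵘ-divℕ z d) ⟩
    mkℚᵘ (+ ℤ.∣ z ∣) d                 ≃⟨ toℚᵘ-divℕ (+ ℤ.∣ z ∣) d ⟨
    toℚᵘ (divℕ (+ ℤ.∣ z ∣) (suc d))    ∎)
    where open ℚᵘ.≤-Reasoning

  divℕ-mono-≤ : ∀ p q {a b} → 1 ℕ.≤ a → 1 ℕ.≤ b → p ℕ.* b ℕ.≤ q ℕ.* a → divℕ (+ p) a ≤ divℕ (+ q) b
  divℕ-mono-≤ p q {suc a} {suc b} _ _ pb≤qa = ℚ.toℚᵘ-cancel-≤ (begin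
    toℚᵘ (divℕ (+ p) (suc a))  ≃⟨ toℚᵘ-divℕ (+ p) a ⟩
    mkℚᵘ (+ p) a               ≤⟨ ℚᵘ.*≤* (subst₂ ℤ._≤_ (ℤ.pos-* p (suc b)) (ℤ.pos-* q (suc a)) (ℤ.+≤+ pb≤qa)) ⟩
    mkℚᵘ (+ q) b               ≃⟨ toℚᵘ-divℕ (+ q) b ⟨
    toℚᵘ (divℕ (+ q) (suc b))  ∎)
    where open ℚᵘ.≤-Reasoning

  archimedean : ∀ ε → 0ℚ < ε → ∀ C → Σ ℕ λ M → ∀ n → M ℕ.≤ n → divℕ (+ C) (suc n) < ε
  archimedean (mkℚ (+ 0)      _ _) (*<* (ℤ.+<+ ()))
  archimedean (mkℚ -[1+ _ ]   _ _) (*<* ())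
  archimedean ε@(mkℚ (+ suc p) d-1 _) _ C = C ℕ.* suc d-1 , λ n M≤n → ℚ.toℚᵘ-cancel-< (begin-strict
    toℚᵘ (divℕ (+ C) (suc n))  ≃⟨ toℚᵘ-divℕ (+ C) n ⟩
    mkℚᵘ (+ C) n               <⟨ ℚᵘ.*<* (subst (ℤ._< _) (ℤ.pos-* C (suc d-1))
                                    (ℤ.+<+ (ℕ.<-≤-trans (s≤s M≤n) (ℕ.m≤n*m (suc n) (suc p))))) ⟩
    toℚᵘ ε                     ∎)
    where open ℚᵘ.≤-Reasoning

  sign-suc : ∀ m → sign (suc m) ≡ - sign m
  sign-suc m = fromℤ-neg (sgn m)

  sign-suc-suc : ∀ m → sign (suc (suc m)) ≡ sign m
  sign-suc-suc m = cong fromℤ (ℤ.neg-involutive (sgn m))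

  sign-+ : ∀ m n → sign (m ℕ.+ n) ≡ sign m * sign n
  sign-+ m n = trans (cong fromℤ (sgn-+ m n)) (fromℤ-* (sgn m) (sgn n))

  sign-even : ∀ m → sign (m ℕ.+ m) ≡ 1ℚ
  sign-even m = cong fromℤ (sgn-even m)

  sign*sign : ∀ m → sign m * sign m ≡ 1ℚ
  sign*sign m = trans (sym (sign-+ m m)) (sign-even m)

  recip-antimono : ∀ {a b} → 1 ℕ.≤ a → a ℕ.≤ b → recip b ≤ recip a
  recip-antimono a≥1 a≤b = divℕ-mono-≤ 1 1 (ℕ.≤-trans a≥1 a≤b) a≥1 (ℕ.*-monoʳ-≤ 1 a≤b)

  0≤divℕ : ∀ q {b} → 1 ℕ.≤ b → 0ℚ ≤ divℕ (+ q) b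
  0≤divℕ q b≥1 = divℕ-mono-≤ 0 q ℕ.≤-refl b≥1 z≤n

  ∣sign*recip∣≤1 : ∀ m {n} → 1 ℕ.≤ n → ∣ sign m * recip n ∣ ≤ 1ℚ
  ∣sign*recip∣≤1 m {n} n≥1 = begin
    ∣ sign m * recip n ∣          ≡⟨ cong ∣_∣ (divℕ≡fromℤ*recip (sgn m) n) ⟨
    ∣ divℕ (sgn m) n ∣            ≡⟨ ∣divℕ∣ (sgn m) n ⟩
    divℕ (+ ℤ.∣ sgn m ∣) n        ≡⟨ cong (λ a → divℕ (+ a) n) (∣sgn∣≡1 m) ⟩
    recip n                       ≤⟨ recip-antimono ℕ.≤-refl n≥1 ⟩
    1ℚ                            ∎
    where open ℚ.≤-Reasoning

  ∣p*q∣≤∣q∣ : ∀ p q → ∣ p ∣ ≤ 1ℚ → ∣ p * q ∣ ≤ ∣ q ∣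
  ∣p*q∣≤∣q∣ p q ∣p∣≤1 = begin
    ∣ p * q ∣        ≡⟨ ℚ.∣p*q∣≡∣p∣*∣q∣ p q ⟩
    ∣ p ∣ * ∣ q ∣    ≤⟨ ℚ.*-monoʳ-≤-nonNeg ∣ q ∣ {{ℚ.∣-∣-nonNeg q}} ∣p∣≤1 ⟩
    1ℚ * ∣ q ∣       ≡⟨ ℚ.*-identityˡ ∣ q ∣ ⟩
    ∣ q ∣            ∎
    where open ℚ.≤-Reasoning

  p-q≤p : ∀ p {q} → 0ℚ ≤ q → p - q ≤ p
  p-q≤p p 0≤q = ℚ.≤-trans (ℚ.+-monoʳ-≤ p (ℚ.neg-antimono-≤ 0≤q)) (ℚ.≤-reflexive (ℚ.+-identityʳ p))

module Series where

  open import Data.Nat.Base as ℕ using (ℕ; zero; suc)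
  import Data.Nat.Properties as ℕ
  open import Data.Integer.Base using (+_)
  open import Data.Rational.Base using (ℚ; 0ℚ; 1ℚ; _+_; _*_; _-_; ∣_∣; _≤_; _<_)
  import Data.Rational.Properties as ℚ
  open import Data.Rational.Solver using (module +-*-Solver)
  open import Data.Product.Base using (_,_)
  open import Data.Sum.Base using (inj₁; inj₂)
  open import Relation.Binary.PropositionalEquality
  open +-*-Solver
  open Rationals

  sumFrom1-cong : ∀ {f g} i → (∀ l → f (suc l) ≡ g (suc l)) → sumFrom1 i f ≡ sumFrom1 i g
  sumFrom1-cong zero    f≗g = refl
  sumFrom1-cong (suc i) f≗g = cong₂ _+_ (sumFrom1-cong i f≗g) (f≗g i)

  interchange : ∀ a b c d → (a + b) + (c + d) ≡ (a + c) + (b + d)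
  interchange = solve 4 (λ a b c d → (a :+ b) :+ (c :+ d) := (a :+ c) :+ (b :+ d)) refl

  sumFrom1-+ : ∀ f g i → sumFrom1 i f + sumFrom1 i g ≡ sumFrom1 i (λ l → f l + g l)
  sumFrom1-+ f g zero    = refl
  sumFrom1-+ f g (suc i) = trans (interchange (sumFrom1 i f) (f (suc i)) (sumFrom1 i g) (g (suc i)))
                                 (cong (_+ (f (suc i) + g (suc i))) (sumFrom1-+ f g i))

  sumFrom1-*ˡ : ∀ c f i → sumFrom1 i (λ l → c * f l) ≡ c * sumFrom1 i f
  sumFrom1-*ˡ c f zero    = sym (ℚ.*-zeroʳ c)
  sumFrom1-*ˡ c f (suc i) = trans (cong (_+ c * f (suc i)) (sumFrom1-*ˡ c f i))
                                  (sym (ℚ.*-distribˡ-+ c (sumFrom1 i f) (f (suc i))))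

  [x-y]+[y-z]≡x-z : ∀ x y z → (x - y) + (y - z) ≡ x - z
  [x-y]+[y-z]≡x-z = solve 3 (λ x y z → (x :- y) :+ (y :- z) := x :- z) refl

  sumFrom1-telescope : ∀ (a : ℕ → ℚ) i → sumFrom1 i (λ l → a l - a (suc l)) ≡ a 1 - a (suc i)
  sumFrom1-telescope a zero    = sym (ℚ.+-inverseʳ (a 1))
  sumFrom1-telescope a (suc i) = trans (cong (_+ (a (suc i) - a (suc (suc i)))) (sumFrom1-telescope a i))
                                       ([x-y]+[y-z]≡x-z (a 1) (a (suc i)) (a (suc (suc i))))

  ∣sumFrom1∣≤ : ∀ f b i → (∀ l → ∣ f (suc l) ∣ ≤ b) → ∣ sumFrom1 i f ∣ ≤ fromℤ (+ i) * b
  ∣sumFrom1∣≤ f b zero    _     = ℚ.≤-reflexive (sym (ℚ.*-zeroˡ b))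
  ∣sumFrom1∣≤ f b (suc i) bound = begin
    ∣ sumFrom1 i f + f (suc i) ∣        ≤⟨ ℚ.∣p+q∣≤∣p∣+∣q∣ (sumFrom1 i f) (f (suc i)) ⟩
    ∣ sumFrom1 i f ∣ + ∣ f (suc i) ∣    ≤⟨ ℚ.+-mono-≤ (∣sumFrom1∣≤ f b i bound) (bound i) ⟩
    fromℤ (+ i) * b + b                 ≡⟨ solve 2 (λ x b → x :* b :+ b := (con 1ℚ :+ x) :* b) refl (fromℤ (+ i)) b ⟩
    (1ℚ + fromℤ (+ i)) * b              ≡⟨ cong (_* b) (fromℤ-+ (+ 1) (+ i)) ⟨
    fromℤ (+ suc i) * b                 ∎
    where open ℚ.≤-Reasoning

  convergesTo-by-rate : ∀ s L C → (∀ N → ∣ s N - L ∣ ≤ divℕ (+ C) (suc N)) → ConvergesTo s L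
  convergesTo-by-rate s L C bound ε ε>0 with archimedean ε ε>0 C
  ... | M , small = M , λ N M≤N → ℚ.≤-<-trans (bound N) (small N M≤N)

  ∣x-y∣≡∣y-x∣ : ∀ x y → ∣ x - y ∣ ≡ ∣ y - x ∣
  ∣x-y∣≡∣y-x∣ x y = trans (cong ∣_∣ (solve 2 (λ x y → x :- y := :- (y :- x)) refl x y)) (ℚ.∣-p∣≡∣p∣ (y - x))

  cauchy-by-rate : ∀ s C → (∀ m n → m ℕ.≤ n → ∣ s n - s m ∣ ≤ divℕ (+ C) (suc m)) → Cauchy s
  cauchy-by-rate s C bound ε ε>0 with archimedean ε ε>0 C
  ... | M , small = M , close
    where
    close : ∀ m n → M ℕ.≤ m → M ℕ.≤ n → ∣ s m - s n ∣ < ε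
    close m n M≤m M≤n with ℕ.≤-total m n
    ... | inj₁ m≤n = subst (_< ε) (∣x-y∣≡∣y-x∣ (s n) (s m)) (ℚ.≤-<-trans (bound m n m≤n) (small m M≤m))
    ... | inj₂ n≤m = ℚ.≤-<-trans (bound n m n≤m) (small n M≤n)

  module _ (f : ℕ → ℚ) (u : ℕ → ℚ) (f≤Δu : ∀ n → ∣ f (suc n) ∣ ≤ u n - u (suc n)) where

    sumFrom1-tail : ∀ n d → ∣ sumFrom1 (d ℕ.+ n) f - sumFrom1 n f ∣ ≤ u n - u (d ℕ.+ n)
    sumFrom1-tail n zero    = ℚ.≤-reflexive (trans (cong ∣_∣ (ℚ.+-inverseʳ (sumFrom1 n f))) (sym (ℚ.+-inverseʳ (u n))))
    sumFrom1-tail n (suc d) = begin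
      ∣ (S + f (suc (d ℕ.+ n))) - sumFrom1 n f ∣
        ≡⟨ cong ∣_∣ (solve 3 (λ S t S₀ → (S :+ t) :- S₀ := (S :- S₀) :+ t) refl S (f (suc (d ℕ.+ n))) (sumFrom1 n f)) ⟩
      ∣ (S - sumFrom1 n f) + f (suc (d ℕ.+ n)) ∣
        ≤⟨ ℚ.∣p+q∣≤∣p∣+∣q∣ (S - sumFrom1 n f) (f (suc (d ℕ.+ n))) ⟩
      ∣ S - sumFrom1 n f ∣ + ∣ f (suc (d ℕ.+ n)) ∣
        ≤⟨ ℚ.+-mono-≤ (sumFrom1-tail n d) (f≤Δu (d ℕ.+ n)) ⟩
      (u n - u (d ℕ.+ n)) + (u (d ℕ.+ n) - u (suc d ℕ.+ n))
        ≡⟨ [x-y]+[y-z]≡x-z (u n) (u (d ℕ.+ n)) (u (suc d ℕ.+ n)) ⟩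
      u n - u (suc d ℕ.+ n) ∎
      where
      open ℚ.≤-Reasoning
      S : ℚ
      S = sumFrom1 (d ℕ.+ n) f

    sumFrom1-cauchy : ∀ C → (∀ n → 0ℚ ≤ u n) → (∀ n → u n ≤ divℕ (+ C) (suc n)) → Cauchy (λ N → sumFrom1 N f)
    sumFrom1-cauchy C 0≤u u≤C/n = cauchy-by-rate (λ N → sumFrom1 N f) C bound
      where
      bound : ∀ m n → m ℕ.≤ n → ∣ sumFrom1 n f - sumFrom1 m f ∣ ≤ divℕ (+ C) (suc m)
      bound m n m≤n = subst (λ x → ∣ sumFrom1 x f - sumFrom1 m f ∣ ≤ divℕ (+ C) (suc m)) (ℕ.m∸n+n≡m m≤n) (begin
        ∣ sumFrom1 (n ℕ.∸ m ℕ.+ m) f - sumFrom1 m f ∣  ≤⟨ sumFrom1-tail m (n ℕ.∸ m) ⟩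
        u m - u (n ℕ.∸ m ℕ.+ m)                       ≤⟨ p-q≤p (u m) (0≤u (n ℕ.∸ m ℕ.+ m)) ⟩
        u m                                           ≤⟨ u≤C/n m ⟩
        divℕ (+ C) (suc m)                            ∎)
        where open ℚ.≤-Reasoning

module Majorant where

  open import Data.Nat.Base as ℕ using (ℕ; suc; z≤n; s≤s)
  import Data.Nat.Properties as ℕ
  open import Data.Integer.Base using (+_)
  open import Data.Rational.Base using (ℚ; 0ℚ; 1ℚ; _*_; _-_; _≤_)
  import Data.Rational.Properties as ℚ
  open import Data.Rational.Solver using (module +-*-Solver)
  open import Relation.Binary.PropositionalEquality
  open +-*-Solver
  open Fibonacci
  open Rationals

  majorant : ℕ → ℚ
  majorant n = divℕ (+ 2) (fib (suc n) ℕ.* fib (suc (suc n)))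

  fib[1+n]*fib[2+n]≥1 : ∀ n → 1 ℕ.≤ fib (suc n) ℕ.* fib (suc (suc n))
  fib[1+n]*fib[2+n]≥1 n = ℕ.*-mono-≤ (fib-pos {suc n} (s≤s z≤n)) (fib-pos {suc (suc n)} (s≤s z≤n))

  0≤majorant : ∀ n → 0ℚ ≤ majorant n
  0≤majorant n = 0≤divℕ 2 (fib[1+n]*fib[2+n]≥1 n)

  majorant≤2/[1+n] : ∀ n → majorant n ≤ divℕ (+ 2) (suc n)
  majorant≤2/[1+n] n = divℕ-mono-≤ 2 2 {b = suc n} (fib[1+n]*fib[2+n]≥1 n) (s≤s z≤n) (ℕ.*-monoʳ-≤ 2 (begin
    suc n                                ≡⟨ ℕ.*-identityˡ (suc n) ⟨
    1 ℕ.* suc n                          ≤⟨ ℕ.*-mono-≤ (fib-pos {suc n} (s≤s z≤n)) (1+n≤fib[2+n] n) ⟩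
    fib (suc n) ℕ.* fib (suc (suc n))    ∎))
    where open ℕ.≤-Reasoning

  majorant-sub : ∀ n → majorant n - majorant (suc n) ≡ divℕ (+ 2) (fib (suc n) ℕ.* fib (suc (suc (suc n))))
  majorant-sub n = begin
    majorant n - majorant (suc n)
      ≡⟨ cong₂ _-_ (as-recips a b) (as-recips b c) ⟩
    two * (recip a * recip b) - two * (recip b * recip c)
      ≡⟨ solve 4 (λ t x y z → t :* (x :* y) :- t :* (y :* z) := t :* y :* (x :- z)) refl
                 two (recip a) (recip b) (recip c) ⟩
    two * recip b * (recip a - recip c)
      ≡⟨ cong (two * recip b *_) (recip-sub b (fib-pos {suc n} (s≤s z≤n))) ⟩
    two * recip b * (fromℤ (+ b) * (recip a * recip c))
      ≡⟨ solve 4 (λ t y B w → t :* y :* (B :* w) := t :* (B :* y) :* w) refl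
                 two (recip b) (fromℤ (+ b)) (recip a * recip c) ⟩
    two * (fromℤ (+ b) * recip b) * (recip a * recip c)
      ≡⟨ cong (λ x → two * x * (recip a * recip c)) (fromℤ*recip-self (fib-pos {suc (suc n)} (s≤s z≤n))) ⟩
    two * 1ℚ * (recip a * recip c)
      ≡⟨ cong (_* (recip a * recip c)) (ℚ.*-identityʳ two) ⟩
    two * (recip a * recip c)
      ≡⟨ as-recips a c ⟨
    divℕ (+ 2) (a ℕ.* c) ∎
    where
    open ≡-Reasoning
    a b c : ℕ
    a = fib (suc n)
    b = fib (suc (suc n))
    c = fib (suc (suc (suc n)))
    two : ℚ
    two = fromℤ (+ 2)
    as-recips : ∀ x y → divℕ (+ 2) (x ℕ.* y) ≡ two * (recip x * recip y)
    as-recips x y = trans (divℕ≡fromℤ*recip (+ 2) (x ℕ.* y)) (cong (two *_) (recip-* x y))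

-- Parametrised by r − 1 so that the exponent (r ∸ 1) * (n ∸ 1) of term computes.
module Convergents (r-1 : ℕ) where

  open import Data.Nat.Base as ℕ using (ℕ; zero; suc; z≤n; s≤s)
  import Data.Nat.Properties as ℕ
  import Data.Nat.Tactic.RingSolver as ℕ-Solver
  open import Data.Integer.Base as ℤ using (+_)
  import Data.Integer.Properties as ℤ
  open import Data.Rational.Base using (ℚ; 0ℚ; 1ℚ; _+_; _*_; _-_; -_; ∣_∣; _≤_)
  import Data.Rational.Properties as ℚ
  open import Data.Rational.Solver using (module +-*-Solver)
  open import Relation.Binary.PropositionalEquality
  open +-*-Solver
  open Sign
  open Fibonacci
  open Rationals
  open Series
  open Majorant

  r : ℕ
  r = suc r-1

  F : ℕ → ℕ
  F n = fib (r ℕ.* n)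

  F-pos : ∀ {n} → 1 ℕ.≤ n → 1 ℕ.≤ F n
  F-pos {n} n≥1 = fib-pos {r ℕ.* n} (ℕ.*-mono-≤ (s≤s (z≤n {r-1})) n≥1)

  ratio : ℕ → ℚ
  ratio n = divℕ (+ fib (suc (r ℕ.* n))) (F n)

  ratio-sub : ∀ {n} m → 1 ℕ.≤ n →
    ratio n - ratio (n ℕ.+ m) ≡ divℕ (sgn (r ℕ.* n) ℤ.* + F m) (F n ℕ.* F (n ℕ.+ m))
  ratio-sub {n} m n≥1 = trans (divℕ-sub _ _ (F-pos n≥1) (F-pos (ℕ.≤-trans n≥1 (ℕ.m≤m+n n m))))
                              (cong (λ z → divℕ z (F n ℕ.* F (n ℕ.+ m))) numerator)
    where
    numerator : + fib (suc (r ℕ.* n)) ℤ.* + F (n ℕ.+ m) ℤ.- + fib (suc (r ℕ.* (n ℕ.+ m))) ℤ.* + F n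
              ≡ sgn (r ℕ.* n) ℤ.* + F m
    numerator = trans (cong (λ x → + fib (suc (r ℕ.* n)) ℤ.* + fib x ℤ.- + fib (suc x) ℤ.* + F n)
                            (ℕ.*-distribˡ-+ r n m))
                      (fib-dOcagne (r ℕ.* n) (r ℕ.* m))

  termSign : ℕ → ℚ
  termSign n = sign (r-1 ℕ.* (n ℕ.∸ 1)) * sign (r ℕ.* n)

  term≡ : ∀ {k n} → 1 ℕ.≤ k → 1 ℕ.≤ n →
    term r k n ≡ termSign n * recip (F k) * (ratio n - ratio (n ℕ.+ k))
  term≡ {k} {n} k≥1 n≥1 = sym (begin
    s * t * recip K * (ratio n - ratio (n ℕ.+ k))
      ≡⟨ cong (s * t * recip K *_) (trans (ratio-sub k n≥1) (divℕ≡fromℤ*recip _ D)) ⟩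
    s * t * recip K * (fromℤ (sgn (r ℕ.* n) ℤ.* + K) * recip D)
      ≡⟨ cong (λ x → s * t * recip K * (x * recip D)) (fromℤ-* (sgn (r ℕ.* n)) (+ K)) ⟩
    s * t * recip K * (t * fromℤ (+ K) * recip D)
      ≡⟨ solve 5 (λ s t i κ d → s :* t :* i :* (t :* κ :* d) := s :* (t :* t) :* (κ :* i) :* d) refl
                 s t (recip K) (fromℤ (+ K)) (recip D) ⟩
    s * (t * t) * (fromℤ (+ K) * recip K) * recip D
      ≡⟨ cong₂ (λ x y → s * x * y * recip D) (sign*sign (r ℕ.* n)) (fromℤ*recip-self (F-pos k≥1)) ⟩
    s * 1ℚ * 1ℚ * recip D
      ≡⟨ cong (_* recip D) (trans (ℚ.*-identityʳ (s * 1ℚ)) (ℚ.*-identityʳ s)) ⟩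
    s * recip D
      ≡⟨ divℕ≡fromℤ*recip _ D ⟨
    term r k n ∎)
    where
    open ≡-Reasoning
    s t : ℚ
    s = sign (r-1 ℕ.* (n ℕ.∸ 1))
    t = sign (r ℕ.* n)
    K D : ℕ
    K = F k
    D = F n ℕ.* F (n ℕ.+ k)

  termSign-suc : ∀ N → termSign (suc N) ≡ sign (N ℕ.+ r)
  termSign-suc N = begin
    sign (r-1 ℕ.* N) * sign (r ℕ.* suc N)          ≡⟨ sign-+ (r-1 ℕ.* N) (r ℕ.* suc N) ⟨
    sign (r-1 ℕ.* N ℕ.+ r ℕ.* suc N)               ≡⟨ cong sign (exponent r-1 N) ⟩
    sign ((r-1 ℕ.* N ℕ.+ r-1 ℕ.* N) ℕ.+ (N ℕ.+ r))  ≡⟨ sign-+ (r-1 ℕ.* N ℕ.+ r-1 ℕ.* N) (N ℕ.+ r) ⟩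
    sign (r-1 ℕ.* N ℕ.+ r-1 ℕ.* N) * sign (N ℕ.+ r) ≡⟨ cong (_* sign (N ℕ.+ r)) (sign-even (r-1 ℕ.* N)) ⟩
    1ℚ * sign (N ℕ.+ r)                             ≡⟨ ℚ.*-identityˡ (sign (N ℕ.+ r)) ⟩
    sign (N ℕ.+ r)                                  ∎
    where
    open ≡-Reasoning
    exponent : ∀ a N → a ℕ.* N ℕ.+ suc a ℕ.* suc N ≡ (a ℕ.* N ℕ.+ a ℕ.* N) ℕ.+ (N ℕ.+ suc a)
    exponent = ℕ-Solver.solve-∀

  gap : ℕ → ℚ
  gap m = ratio m - ratio (suc m)

  gap≡ : ∀ {m} → 1 ℕ.≤ m → gap m ≡ divℕ (sgn (r ℕ.* m) ℤ.* + fib r) (F m ℕ.* F (suc m))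
  gap≡ {m} m≥1 = begin
    ratio m - ratio (suc m)
      ≡⟨ cong (λ x → ratio m - ratio x) (ℕ.+-comm 1 m) ⟩
    ratio m - ratio (m ℕ.+ 1)
      ≡⟨ ratio-sub 1 m≥1 ⟩
    divℕ (sgn (r ℕ.* m) ℤ.* + F 1) (F m ℕ.* F (m ℕ.+ 1))
      ≡⟨ cong₂ (λ a b → divℕ (sgn (r ℕ.* m) ℤ.* + fib a) (F m ℕ.* F b)) (ℕ.*-identityʳ r) (ℕ.+-comm m 1) ⟩
    divℕ (sgn (r ℕ.* m) ℤ.* + fib r) (F m ℕ.* F (suc m)) ∎
    where open ≡-Reasoning

  ∣gap∣≤recip[F] : ∀ {m} → 1 ℕ.≤ m → ∣ gap m ∣ ≤ recip (F m)
  ∣gap∣≤recip[F] {m} m≥1 = begin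
    ∣ gap m ∣                                   ≡⟨ cong ∣_∣ (gap≡ m≥1) ⟩
    ∣ divℕ (sgn (r ℕ.* m) ℤ.* + fib r) D ∣      ≡⟨ ∣divℕ∣ (sgn (r ℕ.* m) ℤ.* + fib r) D ⟩
    divℕ (+ ℤ.∣ sgn (r ℕ.* m) ℤ.* + fib r ∣) D  ≡⟨ cong (λ a → divℕ (+ a) D) ∣sgn*F∣ ⟩
    divℕ (+ fib r) D                            ≤⟨ divℕ-mono-≤ (fib r) 1 D≥1 (F-pos m≥1) cross ⟩
    recip (F m)                                 ∎
    where
    open ℚ.≤-Reasoning
    D : ℕ
    D = F m ℕ.* F (suc m)
    D≥1 : 1 ℕ.≤ D
    D≥1 = ℕ.*-mono-≤ (F-pos m≥1) (F-pos {suc m} (s≤s z≤n))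
    ∣sgn*F∣ : ℤ.∣ sgn (r ℕ.* m) ℤ.* + fib r ∣ ≡ fib r
    ∣sgn*F∣ = trans (ℤ.abs-* (sgn (r ℕ.* m)) (+ fib r))
                    (trans (cong (ℕ._* fib r) (∣sgn∣≡1 (r ℕ.* m))) (ℕ.*-identityˡ (fib r)))
    cross : fib r ℕ.* F m ℕ.≤ 1 ℕ.* D
    cross = ℕ.≤-trans (ℕ.*-monoˡ-≤ (F m) (fib-mono (ℕ.m≤m*n r (suc m))))
                      (ℕ.≤-reflexive (trans (ℕ.*-comm (F (suc m)) (F m)) (sym (ℕ.*-identityˡ D))))

  gapSum : ℕ → ℕ → ℚ
  gapSum N i = sumFrom1 i (λ l → gap (N ℕ.+ 2 ℕ.* l))

  gapSum-pair : ∀ N i → gapSum N i + gapSum (suc N) i ≡ ratio (N ℕ.+ 2) - ratio (N ℕ.+ 2 ℕ.* suc i)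
  gapSum-pair N i = begin
    gapSum N i + gapSum (suc N) i
      ≡⟨ sumFrom1-+ (λ l → gap (N ℕ.+ 2 ℕ.* l)) (λ l → gap (suc N ℕ.+ 2 ℕ.* l)) i ⟩
    sumFrom1 i (λ l → gap (N ℕ.+ 2 ℕ.* l) + gap (suc (N ℕ.+ 2 ℕ.* l)))
      ≡⟨ sumFrom1-cong i (λ l → two-gaps (suc l)) ⟩
    sumFrom1 i (λ l → ratio (N ℕ.+ 2 ℕ.* l) - ratio (N ℕ.+ 2 ℕ.* suc l))
      ≡⟨ sumFrom1-telescope (λ l → ratio (N ℕ.+ 2 ℕ.* l)) i ⟩
    ratio (N ℕ.+ 2) - ratio (N ℕ.+ 2 ℕ.* suc i) ∎
    where
    open ≡-Reasoning
    index : ∀ N l → suc (suc (N ℕ.+ 2 ℕ.* l)) ≡ N ℕ.+ 2 ℕ.* suc l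
    index = ℕ-Solver.solve-∀
    two-gaps : ∀ l →
      gap (N ℕ.+ 2 ℕ.* l) + gap (suc (N ℕ.+ 2 ℕ.* l)) ≡ ratio (N ℕ.+ 2 ℕ.* l) - ratio (N ℕ.+ 2 ℕ.* suc l)
    two-gaps l = trans ([x-y]+[y-z]≡x-z (ratio x) (ratio (suc x)) (ratio (suc (suc x))))
                       (cong (λ y → ratio x - ratio y) (index N l))
      where
      x : ℕ
      x = N ℕ.+ 2 ℕ.* l

  gapSum-zero : ∀ i → gapSum 0 i ≡ fromℤ (+ fib r) * finiteSum r i
  gapSum-zero i = trans (sumFrom1-cong i even-gap) (sumFrom1-*ˡ (fromℤ (+ fib r)) _ i)
    where
    even-gap : ∀ l → gap (2 ℕ.* suc l) ≡
      fromℤ (+ fib r) * divℕ (+ 1) (fib (2 ℕ.* suc l ℕ.* r) ℕ.* fib (suc (2 ℕ.* suc l) ℕ.* r))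
    even-gap l = begin
      gap m
        ≡⟨ gap≡ {m} (s≤s z≤n) ⟩
      divℕ (sgn (r ℕ.* m) ℤ.* + fib r) (F m ℕ.* F (suc m))
        ≡⟨ cong₂ divℕ numerator (cong₂ (λ a b → fib a ℕ.* fib b) (ℕ.*-comm r m) (ℕ.*-comm r (suc m))) ⟩
      divℕ (+ fib r) (fib (m ℕ.* r) ℕ.* fib (suc m ℕ.* r))
        ≡⟨ divℕ≡fromℤ*recip (+ fib r) (fib (m ℕ.* r) ℕ.* fib (suc m ℕ.* r)) ⟩
      fromℤ (+ fib r) * recip (fib (m ℕ.* r) ℕ.* fib (suc m ℕ.* r)) ∎
      where
      open ≡-Reasoning
      m : ℕ
      m = 2 ℕ.* suc l
      double : ∀ r l → r ℕ.* (2 ℕ.* l) ≡ r ℕ.* l ℕ.+ r ℕ.* l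
      double = ℕ-Solver.solve-∀
      numerator : sgn (r ℕ.* m) ℤ.* + fib r ≡ + fib r
      numerator = begin
        sgn (r ℕ.* m) ℤ.* + fib r                       ≡⟨ cong (λ e → sgn e ℤ.* + fib r) (double r (suc l)) ⟩
        sgn (r ℕ.* suc l ℕ.+ r ℕ.* suc l) ℤ.* + fib r   ≡⟨ cong (ℤ._* + fib r) (sgn-even (r ℕ.* suc l)) ⟩
        + 1 ℤ.* + fib r                                 ≡⟨ ℤ.*-identityˡ (+ fib r) ⟩
        + fib r                                         ∎

  ∣gapSum∣≤ : ∀ N i → ∣ gapSum N i ∣ ≤ fromℤ (+ i) * recip (suc N)
  ∣gapSum∣≤ N i = ∣sumFrom1∣≤ _ (recip (suc N)) i bound
    where
    bound : ∀ l → ∣ gap (N ℕ.+ 2 ℕ.* suc l) ∣ ≤ recip (suc N)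
    bound l = ℚ.≤-trans (∣gap∣≤recip[F] (ℕ.≤-trans (s≤s z≤n) 2+N≤m)) (recip-antimono (s≤s z≤n) (begin
      suc N                  ≤⟨ 1+n≤fib[2+n] N ⟩
      fib (suc (suc N))      ≤⟨ fib-mono (ℕ.≤-trans 2+N≤m (ℕ.m≤n*m m r)) ⟩
      F m                    ∎))
      where
      open ℕ.≤-Reasoning
      m : ℕ
      m = N ℕ.+ 2 ℕ.* suc l
      2+N≤m : 2 ℕ.+ N ℕ.≤ m
      2+N≤m = ℕ.≤-trans (ℕ.≤-reflexive (ℕ.+-comm 2 N)) (ℕ.+-monoʳ-≤ N (ℕ.*-monoʳ-≤ 2 (s≤s z≤n)))

  ∣term∣≤majorant-sub : ∀ {k} → 1 ℕ.≤ k → ∀ n → ∣ term r k (suc n) ∣ ≤ majorant n - majorant (suc n)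
  ∣term∣≤majorant-sub {k} k≥1 n = begin
    ∣ term r k (suc n) ∣               ≡⟨ ∣divℕ∣ (sgn (r-1 ℕ.* n)) D ⟩
    divℕ (+ ℤ.∣ sgn (r-1 ℕ.* n) ∣) D   ≡⟨ cong (λ a → divℕ (+ a) D) (∣sgn∣≡1 (r-1 ℕ.* n)) ⟩
    recip D                            ≤⟨ divℕ-mono-≤ 1 2 D≥1 ac≥1 cross ⟩
    divℕ (+ 2) (a ℕ.* c)               ≡⟨ majorant-sub n ⟨
    majorant n - majorant (suc n)      ∎
    where
    open ℚ.≤-Reasoning
    D a c : ℕ
    D = F (suc n) ℕ.* F (suc n ℕ.+ k)
    a = fib (suc n)
    c = fib (suc (suc (suc n)))
    D≥1 : 1 ℕ.≤ D
    D≥1 = ℕ.*-mono-≤ (F-pos {suc n} (s≤s z≤n)) (F-pos {suc n ℕ.+ k} (s≤s z≤n))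
    ac≥1 : 1 ℕ.≤ a ℕ.* c
    ac≥1 = ℕ.*-mono-≤ (fib-pos {suc n} (s≤s z≤n)) (fib-pos {suc (suc (suc n))} (s≤s z≤n))
    c≤2F : c ℕ.≤ 2 ℕ.* F (suc n ℕ.+ k)
    c≤2F = ℕ.≤-trans (fib[2+n]≤2*fib[1+n] (suc n))
             (ℕ.*-monoʳ-≤ 2 (fib-mono (ℕ.≤-trans (ℕ.m<m+n (suc n) k≥1) (ℕ.m≤n*m (suc n ℕ.+ k) r))))
    swap : ∀ x y → x ℕ.* (2 ℕ.* y) ≡ 2 ℕ.* (x ℕ.* y)
    swap = ℕ-Solver.solve-∀
    cross : 1 ℕ.* (a ℕ.* c) ℕ.≤ 2 ℕ.* D
    cross = ℕ.≤-trans (ℕ.≤-reflexive (ℕ.*-identityˡ (a ℕ.* c)))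
              (ℕ.≤-trans (ℕ.*-mono-≤ (fib-mono (ℕ.m≤n*m (suc n) r)) c≤2F)
                         (ℕ.≤-reflexive (swap (F (suc n)) (F (suc n ℕ.+ k)))))

  partialS-cauchy : ∀ {k} → 1 ℕ.≤ k → Cauchy (partialS r k)
  partialS-cauchy k≥1 = sumFrom1-cauchy (term r _) majorant (∣term∣≤majorant-sub k≥1) 2 0≤majorant majorant≤2/[1+n]

  module OddShift (j : ℕ) where

    k : ℕ
    k = suc (2 ℕ.* j)

    K : ℕ
    K = F k

    c : ℚ
    c = divℕ (+ fib r) K

    combination : ℕ → ℚ
    combination N = partialS r k N - c * partialS r 1 N

    limit : ℚ
    limit = c * (sign r * finiteSum r j)

    error : ℕ → ℚ
    error N = sign (suc (N ℕ.+ r)) * recip K * gapSum N j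

    term-combination : ∀ {n} → 1 ℕ.≤ n →
      term r k n - c * term r 1 n ≡ termSign n * recip K * (ratio (n ℕ.+ 1) - ratio (n ℕ.+ k))
    term-combination {n} n≥1 = begin
      term r k n - c * term r 1 n
        ≡⟨ cong₂ (λ x y → x - c * y) (term≡ (s≤s z≤n) n≥1) (term≡ (s≤s z≤n) n≥1) ⟩
      P * recip K * (x - y) - c * (P * recip F₁ * (x - x₁))
        ≡⟨ cong (λ a → P * recip K * (x - y) - a * (P * recip F₁ * (x - x₁))) (divℕ≡fromℤ*recip (+ fib r) K) ⟩
      P * recip K * (x - y) - fromℤ (+ fib r) * recip K * (P * recip F₁ * (x - x₁))
        ≡⟨ solve 7 (λ P i f g x y x₁ → P :* i :* (x :- y) :- f :* i :* (P :* g :* (x :- x₁))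
                                      := P :* i :* (x :- y) :- P :* i :* (f :* g) :* (x :- x₁)) refl
                   P (recip K) (fromℤ (+ fib r)) (recip F₁) x y x₁ ⟩
      P * recip K * (x - y) - P * recip K * (fromℤ (+ fib r) * recip F₁) * (x - x₁)
        ≡⟨ cong (λ a → P * recip K * (x - y) - P * recip K * a * (x - x₁)) F*recipF₁ ⟩
      P * recip K * (x - y) - P * recip K * 1ℚ * (x - x₁)
        ≡⟨ solve 4 (λ Q x y x₁ → Q :* (x :- y) :- Q :* con 1ℚ :* (x :- x₁) := Q :* (x₁ :- y)) refl (P * recip K) x y x₁ ⟩
      P * recip K * (x₁ - y) ∎
      where
      open ≡-Reasoning
      F₁ : ℕ
      F₁ = F 1
      P x y x₁ : ℚ
      P = termSign n
      x = ratio n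
      y = ratio (n ℕ.+ k)
      x₁ = ratio (n ℕ.+ 1)
      F*recipF₁ : fromℤ (+ fib r) * recip F₁ ≡ 1ℚ
      F*recipF₁ = trans (cong (λ a → fromℤ (+ fib r) * recip (fib a)) (ℕ.*-identityʳ r))
                        (fromℤ*recip-self (fib-pos {r} (s≤s z≤n)))

    combination-suc : ∀ N → combination (suc N) ≡ combination N + sign (N ℕ.+ r) * recip K * (gapSum N j + gapSum (suc N) j)
    combination-suc N = begin
      (partialS r k N + term r k n) - c * (partialS r 1 N + term r 1 n)
        ≡⟨ solve 5 (λ p q c t u → (p :+ t) :- c :* (q :+ u) := (p :- c :* q) :+ (t :- c :* u)) refl
                   (partialS r k N) (partialS r 1 N) c (term r k n) (term r 1 n) ⟩
      combination N + (term r k n - c * term r 1 n)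
        ≡⟨ cong (λ a → combination N + a) (term-combination (s≤s z≤n)) ⟩
      combination N + termSign n * recip K * (ratio (n ℕ.+ 1) - ratio (n ℕ.+ k))
        ≡⟨ cong₂ (λ s d → combination N + s * recip K * d) (termSign-suc N)
                 (trans (cong₂ (λ a b → ratio a - ratio b) (index₁ N) (indexₖ N j)) (sym (gapSum-pair N j))) ⟩
      combination N + sign (N ℕ.+ r) * recip K * (gapSum N j + gapSum (suc N) j) ∎
      where
      open ≡-Reasoning
      n : ℕ
      n = suc N
      index₁ : ∀ N → suc N ℕ.+ 1 ≡ N ℕ.+ 2
      index₁ = ℕ-Solver.solve-∀
      indexₖ : ∀ N j → suc N ℕ.+ suc (2 ℕ.* j) ≡ N ℕ.+ 2 ℕ.* suc j
      indexₖ = ℕ-Solver.solve-∀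

    combination≡limit+error : ∀ N → combination N ≡ limit + error N
    combination≡limit+error zero = sym (begin
      c * (sign r * S) + sign (suc r) * recip K * gapSum 0 j
        ≡⟨ cong₂ (λ a b → a * (sign r * S) + b) c≡f*recipK
                 (cong₂ (λ s g → s * recip K * g) (sign-suc r) (gapSum-zero j)) ⟩
      f * recip K * (sign r * S) + - sign r * recip K * (f * S)
        ≡⟨ solve 4 (λ f i s S → f :* i :* (s :* S) :+ :- s :* i :* (f :* S) := con 0ℚ :- f :* i :* con 0ℚ) refl
                   f (recip K) (sign r) S ⟩
      0ℚ - f * recip K * 0ℚ
        ≡⟨ cong (λ a → 0ℚ - a * 0ℚ) c≡f*recipK ⟨
      combination 0 ∎)
      where
      open ≡-Reasoning
      S f : ℚ
      S = finiteSum r j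
      f = fromℤ (+ fib r)
      c≡f*recipK : c ≡ f * recip K
      c≡f*recipK = divℕ≡fromℤ*recip (+ fib r) K
    combination≡limit+error (suc N) = begin
      combination (suc N)
        ≡⟨ combination-suc N ⟩
      combination N + s * recip K * (g₀ + g₁)
        ≡⟨ cong (_+ s * recip K * (g₀ + g₁)) (combination≡limit+error N) ⟩
      (limit + sign (suc (N ℕ.+ r)) * recip K * g₀) + s * recip K * (g₀ + g₁)
        ≡⟨ cong (λ a → (limit + a * recip K * g₀) + s * recip K * (g₀ + g₁)) (sign-suc (N ℕ.+ r)) ⟩
      (limit + - s * recip K * g₀) + s * recip K * (g₀ + g₁)
        ≡⟨ solve 5 (λ L s i g₀ g₁ → (L :+ :- s :* i :* g₀) :+ s :* i :* (g₀ :+ g₁) := L :+ s :* i :* g₁) refl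
                   limit s (recip K) g₀ g₁ ⟩
      limit + s * recip K * g₁
        ≡⟨ cong (λ a → limit + a * recip K * g₁) (sign-suc-suc (N ℕ.+ r)) ⟨
      limit + error (suc N) ∎
      where
      open ≡-Reasoning
      s g₀ g₁ : ℚ
      s = sign (N ℕ.+ r)
      g₀ = gapSum N j
      g₁ = gapSum (suc N) j

    convergence : ConvergesTo combination limit
    convergence = convergesTo-by-rate combination limit j λ N → begin
      ∣ combination N - limit ∣              ≡⟨ cong (λ a → ∣ a - limit ∣) (combination≡limit+error N) ⟩
      ∣ (limit + error N) - limit ∣          ≡⟨ cong ∣_∣ (solve 2 (λ L e → (L :+ e) :- L := e) refl limit (error N)) ⟩
      ∣ error N ∣                            ≤⟨ ∣p*q∣≤∣q∣ _ (gapSum N j) (∣sign*recip∣≤1 (suc (N ℕ.+ r)) (F-pos {k} (s≤s z≤n))) ⟩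
      ∣ gapSum N j ∣                         ≤⟨ ∣gapSum∣≤ N j ⟩
      fromℤ (+ j) * recip (suc N)            ≡⟨ divℕ≡fromℤ*recip (+ j) (suc N) ⟨
      divℕ (+ j) (suc N)                     ∎
      where open ℚ.≤-Reasoning

open import Data.Nat using (ℕ; _≤_; _%_; _∸_; _/_; _*_)
open import Data.Rational using (ℚ) renaming (_*_ to _*ℚ_; _-_ to _-ℚ_; _+_ to _+ℚ_)
open import Data.Integer using (+_)
open import Data.Product using (_×_)
open import Relation.Binary.PropositionalEquality using (_≡_)
open import Data.Nat using (suc; _+_; s≤s; z≤n)
open import Data.Nat.Properties using (*-comm)
open import Data.Nat.DivMod using (m≡m%n+[m/n]*n; m*n/n≡m)
open import Data.Product using (_,_)
open import Relation.Binary.PropositionalEquality using (refl; trans; cong)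

odd≡suc[2*half] : ∀ k → k % 2 ≡ 1 → k ≡ suc (2 * (k / 2))
odd≡suc[2*half] k k-odd = trans (m≡m%n+[m/n]*n k 2) (trans (cong (_+ k / 2 * 2) k-odd) (cong suc (*-comm (k / 2) 2)))

half-of-odd : ∀ j → (suc (2 * j) ∸ 1) / 2 ≡ j
half-of-odd j = trans (cong (_/ 2) (*-comm 2 j)) (m*n/n≡m j 2)

theorem2p7 : (r k : ℕ) → 1 ≤ r → 1 ≤ k → k % 2 ≡ 1 →
    Cauchy (partialS r k) × Cauchy (partialS r 1) ×
    ConvergesTo (λ N → partialS r k N -ℚ (divℕ (+ fib r) (fib (r * k)) *ℚ partialS r 1 N))
                (divℕ (+ fib r) (fib (r * k)) *ℚ (divℕ (sgn r) 1 *ℚ finiteSum r ((k ∸ 1) / 2)))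
theorem2p7 (suc r-1) k _ k≥1 k-odd with k / 2 | odd≡suc[2*half] k k-odd
... | j | refl rewrite half-of-odd j = partialS-cauchy k≥1 , partialS-cauchy (s≤s z≤n) , OddShift.convergence j
  where open Convergents r-1
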